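{- Let $G=(V,E)$ be a connected interval graph with $n$ vertices, and let $u_1,u_2,\dots,u_n$ be its vertices ordered by increasing left endpoints of the intervals of a fixed interval representation. For $1\le i\le n$ let $V_i=\{u_j : j\le i\}$. Define $F(u_1)=u_1$ and, for $i\ge 2$, $F(u_i)=u_j$ where $j=\min\{k : u_ku_i\in E,\ k<i\}$. If $F(u_i)\neq u_i$ and $F(F(u_i))=F(u_i)$, then $\{u_i,F(u_i)\}$ is a minimum paired-dominating set of $G[V_i]$.
   Context: An interval graph is a graph having an interval representation, i.e. a family of intervals assigned to the vertices such that two vertices are adjacent iff their intervals intersect. A set $S$ of vertices of a graph $H$ without isolated vertices is a paired-dominating set if every vertex not in $S$ is adjacent to a vertex of $S$ and the induced subgraph $H[S]$ has a perfect matching; a minimum paired-dominating set is one of minimum cardinality. $G[V_i]$ denotes the subgraph induced by $V_i$ (it is connected since $G$ is connected). -}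

module Defs where

open import Data.Nat as ℕ using (ℕ)
open import Data.Fin as Fin using (Fin; toℕ)
open import Data.Fin.Subset using (Subset; _∈_; _∉_; ∣_∣)
open import Data.List using (List; filter; allFin)
open import Data.List.Base using (head)
open import Data.Maybe using (Maybe; just; nothing)
open import Data.Fin.Base using (_<_; _≤_)
open import Data.Product using (Σ; ∃; _×_; _,_)
open import Relation.Binary.PropositionalEquality using (_≡_; _≢_)
open import Relation.Nullary using (Dec; ¬?)
open import Relation.Nullary.Decidable using (_×-dec_)

-- An interval representation of a graph on vertex set Fin n:
-- vertex v gets the closed interval [ left v , right v ].
-- (Integer endpoints lose no generality for finite families of intervals.)
-- Vertex u_{k+1} of the paper is the element k : Fin n (0-based indices).
record IntervalRep (n : ℕ) : Set where
  field
    left  : Fin n → ℕ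
    right : Fin n → ℕ
    valid : ∀ v → left v ℕ.≤ right v
open IntervalRep public

Adj : ∀ {n} → IntervalRep n → Fin n → Fin n → Set
Adj I u v = u ≢ v × (left I u ℕ.≤ right I v × left I v ℕ.≤ right I u)

adj? : ∀ {n} (I : IntervalRep n) (u v : Fin n) → Dec (Adj I u v)
adj? I u v = ¬? (u Fin.≟ v) ×-dec (left I u ℕ.≤? right I v ×-dec left I v ℕ.≤? right I u)

SortedByLeft : ∀ {n} → IntervalRep n → Set
SortedByLeft {n} I = ∀ {i j : Fin n} → i ≤ j → left I i ℕ.≤ left I j

data Reach {n} (I : IntervalRep n) : Fin n → Fin n → Set where
  here : ∀ {u} → Reach I u u
  step : ∀ {u v w} → Adj I u v → Reach I v w → Reach I u w

Connected : ∀ {n} → IntervalRep n → Set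
Connected {n} I = ∀ (u v : Fin n) → Reach I u v

F : ∀ {n} → IntervalRep n → Fin n → Fin n
F {n} I i with head (filter (λ k → (k Fin.<? i) ×-dec adj? I k i) (allFin n))
... | just k  = k
... | nothing = i

-- S is a paired-dominating set of G[V_i]:
-- S ⊆ V_i, every vertex of V_i \ S has a neighbour in S, and G[S] has a
-- perfect matching (given by the partner map m: each v ∈ S is matched with
-- m v ∈ S, v and m v adjacent, and m (m v) = v).
PairedDominating : ∀ {n} → IntervalRep n → Fin n → Subset n → Set
PairedDominating {n} I i S =
  (∀ v → v ∈ S → v ≤ i)
  × (∀ v → v ≤ i → v ∉ S → ∃ λ w → w ∈ S × Adj I v w)
  × (Σ (Fin n → Fin n) λ m → ∀ v → v ∈ S → m v ∈ S × Adj I v (m v) × m (m v) ≡ v)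

MinPairedDominating : ∀ {n} → IntervalRep n → Fin n → Subset n → Set
MinPairedDominating {n} I i S =
  PairedDominating I i S × (∀ (T : Subset n) → PairedDominating I i T → ∣ S ∣ ℕ.≤ ∣ T ∣)

module Submission where

-- Unfolding the definition of F: either u_i has no
--    earlier neighbour and F(u_i) = u_i, or F(u_i) is an earlier neighbour.
--    So F(u_j) = u_j means that u_j has no earlier neighbour.
-- 2. Interval geometry.  If u_j has no earlier neighbour, then no edge leaves
--    the prefix {u_k : k < j}, since the intervals are sorted by left
--    endpoint; by connectedness that prefix is empty, so u_j comes first.
--    A neighbour u_j of u_i with j ≤ v ≤ i is adjacent to every such u_v:
--    both intervals contain the left endpoint of u_v.
-- 3. Counting.  Hence u_j dominates V_i and {u_i, u_j}, matched to each
--    other, is paired-dominating in G[V_i].  It has at most two elements,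
--    while every paired-dominating set of G[V_i] has at least two: it is
--    nonempty (it contains or dominates u_i) and its elements have distinct
--    partners.

open import Defs
open import Data.Fin using (Fin)
open import Data.Fin.Subset using (⁅_⁆; _∪_)
open import Relation.Binary.PropositionalEquality using (_≡_; _≢_)

open import Data.Nat as ℕ using (ℕ; z≤n; s≤s)
import Data.Nat.Properties as ℕP
open import Data.Fin as Fin using (toℕ)
open import Data.Fin.Subset using (Subset; _∈_; _∉_; ∣_∣; inside; outside; _-_)
open import Data.Fin.Subset.Properties
  using (x∈p∪q⁻; x∈p∪q⁺; x∈⁅x⁆; x∈⁅y⁆⇒x≡y; _∈?_; ∣⁅x⁆∣≡1;
         x∈p⇒∣p-x∣<∣p∣; x∈p∧x∉q⇒x∈p─q; x≢y⇒x∉⁅y⁆)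
open import Data.Vec using (_∷_; [])
open import Data.List using (List; filter; allFin; head)
import Data.List.Membership.Propositional as List
open import Data.List.Membership.Propositional.Properties using (∈-allFin; ∈-filter⁺; ∈-filter⁻)
import Data.List.Relation.Unary.Any as Any
open import Data.Maybe using (just; nothing)
open import Data.Product using (∃; _×_; _,_; proj₂)
open import Data.Sum using (_⊎_; inj₁; inj₂)
open import Data.Empty using (⊥-elim)
open import Relation.Nullary using (yes; no; ¬_)
open import Relation.Nullary.Decidable using (_×-dec_)
open import Relation.Binary.PropositionalEquality using (refl; sym; cong₂; subst)

head-just⇒∈ : ∀ {A : Set} {xs : List A} {x : A} → head xs ≡ just x → x List.∈ xs
head-just⇒∈ {xs = x Data.List.∷ _} refl = Any.here refl

head-nothing⇒∉ : ∀ {A : Set} {xs : List A} {x : A} → head xs ≡ nothing → ¬ (x List.∈ xs)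
head-nothing⇒∉ {xs = Data.List.[]} _ ()

NoEarlierNeighbour : ∀ {n} → IntervalRep n → Fin n → Set
NoEarlierNeighbour I j = ∀ k → k Fin.< j → ¬ Adj I k j

F-spec : ∀ {n} (I : IntervalRep n) (i : Fin n) →
  (F I i ≡ i × NoEarlierNeighbour I i) ⊎ (F I i Fin.< i × Adj I (F I i) i)
F-spec {n} I i with head (filter (λ k → (k Fin.<? i) ×-dec adj? I k i) (allFin n)) in eq
... | just k  = inj₂ (proj₂ (∈-filter⁻ _ {xs = allFin n} (head-just⇒∈ eq)))
... | nothing = inj₁ (refl , λ k k<i k~i →
                  head-nothing⇒∉ eq (∈-filter⁺ _ (∈-allFin k) (k<i , k~i)))

F-fixed⇒NoEarlierNeighbour : ∀ {n} (I : IntervalRep n) {j : Fin n} →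
  F I j ≡ j → NoEarlierNeighbour I j
F-fixed⇒NoEarlierNeighbour I {j} Fj≡j with F-spec I j
... | inj₁ (_ , none) = none
... | inj₂ (Fj<j , _) = ⊥-elim (ℕP.<-irrefl refl (subst (Fin._< j) Fj≡j Fj<j))

Adj-sym : ∀ {n} {I : IntervalRep n} {u v : Fin n} → Adj I u v → Adj I v u
Adj-sym (u≢v , lu≤rv , lv≤ru) = (λ v≡u → u≢v (sym v≡u)) , lv≤ru , lu≤rv

-- If j has no earlier neighbour, no edge leaves the prefix {k : k < j}:
-- an edge a b with a < j ≤ b would make a adjacent to j, because
-- left a ≤ left j ≤ left b ≤ right a and left j ≤ right j.
prefix-closed : ∀ {n} (I : IntervalRep n) → SortedByLeft I → {j : Fin n} →
  NoEarlierNeighbour I j → ∀ {a b} → a Fin.< j → Adj I a b → b Fin.< j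
prefix-closed I sorted {j} none {a} {b} a<j (_ , _ , lb≤ra) with toℕ b ℕ.<? toℕ j
... | yes b<j = b<j
... | no  b≮j = ⊥-elim (none a a<j (a≢j , la≤rj , lj≤ra))
  where
  a≢j : a ≢ j
  a≢j refl = ℕP.<-irrefl refl a<j
  la≤rj : left I a ℕ.≤ right I j
  la≤rj = ℕP.≤-trans (sorted (ℕP.<⇒≤ a<j)) (valid I j)
  lj≤ra : left I j ℕ.≤ right I a
  lj≤ra = ℕP.≤-trans (sorted (ℕP.≮⇒≥ b≮j)) lb≤ra

reach-prefix : ∀ {n} (I : IntervalRep n) → SortedByLeft I → {j : Fin n} →
  NoEarlierNeighbour I j → ∀ {a w} → a Fin.< j → Reach I a w → w Fin.< j
reach-prefix I sorted none a<j here = a<j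
reach-prefix I sorted none a<j (step a~b b⇝w) =
  reach-prefix I sorted none (prefix-closed I sorted none a<j a~b) b⇝w

-- In a connected sorted interval graph only the first vertex lacks an
-- earlier neighbour: any v < j would reach j without leaving the prefix.
NoEarlierNeighbour⇒first : ∀ {n} (I : IntervalRep n) → SortedByLeft I → Connected I →
  {j : Fin n} → NoEarlierNeighbour I j → ∀ v → j Fin.≤ v
NoEarlierNeighbour⇒first I sorted connected {j} none v with toℕ j ℕ.≤? toℕ v
... | yes j≤v = j≤v
... | no  j≰v = ⊥-elim (ℕP.<-irrefl refl
                  (reach-prefix I sorted none (ℕP.≰⇒> j≰v) (connected v j)))

-- A neighbour j of i dominates every vertex v with j ≤ v ≤ i: the point
-- left v lies in both intervals, as left j ≤ left v ≤ left i ≤ right j.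
neighbour-dominates-between : ∀ {n} (I : IntervalRep n) → SortedByLeft I →
  {i j v : Fin n} → Adj I j i → j Fin.≤ v → v Fin.≤ i → v ≢ j → Adj I v j
neighbour-dominates-between I sorted {v = v} (_ , _ , li≤rj) j≤v v≤i v≢j =
  v≢j , ℕP.≤-trans (sorted v≤i) li≤rj , ℕP.≤-trans (sorted j≤v) (valid I v)

partner : ∀ {n} → Fin n → Fin n → Fin n → Fin n
partner i j v with v Fin.≟ i
... | yes _ = j
... | no  _ = i

partner-at-i : ∀ {n} (i j : Fin n) → partner i j i ≡ j
partner-at-i i j with i Fin.≟ i
... | yes _   = refl
... | no  i≢i = ⊥-elim (i≢i refl)

partner-elsewhere : ∀ {n} (i j v : Fin n) → v ≢ i → partner i j v ≡ i
partner-elsewhere i j v v≢i with v Fin.≟ i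
... | yes v≡i = ⊥-elim (v≢i v≡i)
... | no  _   = refl

∈-pair⁻ : ∀ {n} {i j v : Fin n} → v ∈ ⁅ i ⁆ ∪ ⁅ j ⁆ → v ≡ i ⊎ v ≡ j
∈-pair⁻ {i = i} {j} v∈ with x∈p∪q⁻ ⁅ i ⁆ ⁅ j ⁆ v∈
... | inj₁ v∈⁅i⁆ = inj₁ (x∈⁅y⁆⇒x≡y i v∈⁅i⁆)
... | inj₂ v∈⁅j⁆ = inj₂ (x∈⁅y⁆⇒x≡y j v∈⁅j⁆)

pair-PairedDominating : ∀ {n} (I : IntervalRep n) {i j : Fin n} →
  j Fin.≤ i → Adj I j i → (∀ v → v Fin.≤ i → v ≢ j → Adj I v j) →
  PairedDominating I i (⁅ i ⁆ ∪ ⁅ j ⁆)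
pair-PairedDominating I {i} {j} j≤i j~i@(j≢i , _) j-dominates =
  inside-Vᵢ , dominated , partner i j , matched
  where
  i∈S : i ∈ ⁅ i ⁆ ∪ ⁅ j ⁆
  i∈S = x∈p∪q⁺ (inj₁ (x∈⁅x⁆ i))
  j∈S : j ∈ ⁅ i ⁆ ∪ ⁅ j ⁆
  j∈S = x∈p∪q⁺ (inj₂ (x∈⁅x⁆ j))

  inside-Vᵢ : ∀ v → v ∈ ⁅ i ⁆ ∪ ⁅ j ⁆ → v Fin.≤ i
  inside-Vᵢ v v∈ with ∈-pair⁻ v∈
  ... | inj₁ refl = ℕP.≤-refl
  ... | inj₂ refl = j≤i

  dominated : ∀ v → v Fin.≤ i → v ∉ ⁅ i ⁆ ∪ ⁅ j ⁆ → ∃ λ w → w ∈ ⁅ i ⁆ ∪ ⁅ j ⁆ × Adj I v w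
  dominated v v≤i v∉S = j , j∈S , j-dominates v v≤i (λ { refl → v∉S j∈S })

  matched : ∀ v → v ∈ ⁅ i ⁆ ∪ ⁅ j ⁆ →
    partner i j v ∈ ⁅ i ⁆ ∪ ⁅ j ⁆ × Adj I v (partner i j v) × partner i j (partner i j v) ≡ v
  matched v v∈ with ∈-pair⁻ v∈
  ... | inj₁ refl rewrite partner-at-i v j =
          j∈S , Adj-sym {I = I} j~i , partner-elsewhere v j j j≢i
  ... | inj₂ refl rewrite partner-elsewhere i v v j≢i =
          i∈S , j~i , partner-at-i i v

∣p∪q∣≤∣p∣+∣q∣ : ∀ {n} (p q : Subset n) → ∣ p ∪ q ∣ ℕ.≤ ∣ p ∣ ℕ.+ ∣ q ∣
∣p∪q∣≤∣p∣+∣q∣ []            []            = z≤n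
∣p∪q∣≤∣p∣+∣q∣ (inside  ∷ p) (inside  ∷ q) =
  s≤s (ℕP.≤-trans (∣p∪q∣≤∣p∣+∣q∣ p q) (ℕP.+-monoʳ-≤ ∣ p ∣ (ℕP.n≤1+n _)))
∣p∪q∣≤∣p∣+∣q∣ (inside  ∷ p) (outside ∷ q) = s≤s (∣p∪q∣≤∣p∣+∣q∣ p q)
∣p∪q∣≤∣p∣+∣q∣ (outside ∷ p) (inside  ∷ q) =
  ℕP.≤-trans (s≤s (∣p∪q∣≤∣p∣+∣q∣ p q)) (ℕP.≤-reflexive (sym (ℕP.+-suc ∣ p ∣ ∣ q ∣)))
∣p∪q∣≤∣p∣+∣q∣ (outside ∷ p) (outside ∷ q) = ∣p∪q∣≤∣p∣+∣q∣ p q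

∣pair∣≤2 : ∀ {n} (i j : Fin n) → ∣ ⁅ i ⁆ ∪ ⁅ j ⁆ ∣ ℕ.≤ 2
∣pair∣≤2 i j = ℕP.≤-trans (∣p∪q∣≤∣p∣+∣q∣ ⁅ i ⁆ ⁅ j ⁆)
  (ℕP.≤-reflexive (cong₂ ℕ._+_ (∣⁅x⁆∣≡1 i) (∣⁅x⁆∣≡1 j)))

-- A set with two distinct elements x, y has at least two elements:
-- removing x strictly shrinks it and leaves y behind.
two-elements⇒2≤∣p∣ : ∀ {n} {p : Subset n} {x y : Fin n} → x ∈ p → y ∈ p → x ≢ y → 2 ℕ.≤ ∣ p ∣
two-elements⇒2≤∣p∣ {p = p} {x} {y} x∈p y∈p x≢y =
  ℕP.<-≤-trans (s≤s 1≤∣p-x∣) (x∈p⇒∣p-x∣<∣p∣ x∈p)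
  where
  y∈p-x : y ∈ p - x
  y∈p-x = x∈p∧x∉q⇒x∈p─q y∈p (x≢y⇒x∉⁅y⁆ (λ y≡x → x≢y (sym y≡x)))
  1≤∣p-x∣ : 1 ℕ.≤ ∣ p - x ∣
  1≤∣p-x∣ = ℕP.<-≤-trans (s≤s z≤n) (x∈p⇒∣p-x∣<∣p∣ y∈p-x)

-- Every paired-dominating set of G[V_i] has at least two elements: it has
-- an element (i itself or a dominator of i), whose partner is distinct.
PairedDominating⇒2≤∣T∣ : ∀ {n} (I : IntervalRep n) (i : Fin n) (T : Subset n) →
  PairedDominating I i T → 2 ℕ.≤ ∣ T ∣
PairedDominating⇒2≤∣T∣ I i T (_ , dominated , m , matched) with some-element
  where
  some-element : ∃ λ t → t ∈ T
  some-element with i ∈? T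
  ... | yes i∈T = i , i∈T
  ... | no  i∉T with dominated i ℕP.≤-refl i∉T
  ...   | w , w∈T , _ = w , w∈T
... | t , t∈T with matched t t∈T
...   | mt∈T , (t≢mt , _) , _ = two-elements⇒2≤∣p∣ t∈T mt∈T t≢mt

lemma3p3 : ∀ {n} (I : IntervalRep n) → SortedByLeft I → Connected I →
    (i : Fin n) → F I i ≢ i → F I (F I i) ≡ F I i →
    MinPairedDominating I i (⁅ i ⁆ ∪ ⁅ F I i ⁆)
lemma3p3 I sorted connected i Fi≢i FFi≡Fi with F-spec I i
... | inj₁ (Fi≡i , _)   = ⊥-elim (Fi≢i Fi≡i)
... | inj₂ (Fi<i , Fi~i) = paired-dominating , minimum
  where
  Fi-first : ∀ v → F I i Fin.≤ v
  Fi-first = NoEarlierNeighbour⇒first I sorted connected (F-fixed⇒NoEarlierNeighbour I FFi≡Fi)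
  paired-dominating : PairedDominating I i (⁅ i ⁆ ∪ ⁅ F I i ⁆)
  paired-dominating = pair-PairedDominating I (ℕP.<⇒≤ Fi<i) Fi~i
    (λ v → neighbour-dominates-between I sorted Fi~i (Fi-first v))
  minimum : ∀ T → PairedDominating I i T → ∣ ⁅ i ⁆ ∪ ⁅ F I i ⁆ ∣ ℕ.≤ ∣ T ∣
  minimum T T-pd = ℕP.≤-trans (∣pair∣≤2 i (F I i)) (PairedDominating⇒2≤∣T∣ I i T T-pd)
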